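{- Let $\mathcal{J}=\{J_1,\ldots,J_n\}$ be a set of time-dependent tasks, $J_j$ having integer deadline $d_j$ and nondecreasing execution-time function $p_j\colon\{0,\ldots,d_j-1\}\to\mathbb{N}_+$, let $f_j=\max\{t\in\mathbb{N}\colon t+p_j(t)\le d_j\}$ and $L=\max_j d_j$. Let $T$ be the tree rooted at $r$ built as follows: for each $j$ a path $P_j$ with vertices $u_j^i,v_j^i$ ($i=0,\ldots,f_j$) and edges $u_j^iv_j^i$ ($i=0,\ldots,f_j$) and $v_j^iu_j^{i+1}$ ($i=0,\ldots,f_j-1$); further vertices $r$ and $y_j,z_j$ for $j=0,\ldots,n$; $r$ is adjacent to $y_0$ and to $u_j^{f_j}$ for each $j=1,\ldots,n$; $v_j^0$ is adjacent to $y_j$ for $j=1,\ldots,n$; and $y_j$ is adjacent to $z_j$ for $j=0,\ldots,n$. All edges have weight $1$, and the vertex weights are $w(r)=2L$, $w(y_j)=3L$, $w(z_j)=1$ ($j=0,\ldots,n$), $w(u_j^i)=2L-i$ and $w(v_j^i)=p_j(i)$ ($j=1,\ldots,n$, $i=0,\ldots,f_j$). Then in every monotone connected $4L$-search strategy for $T$ with starting vertex $r$, the edge $ry_0$ is the last one cleared among the edges joining $r$ to its children.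
   Context: Connected searching of a weighted graph ($w$ on vertices and edges, positive integers): a connected $k$-search strategy starts with all edges contaminated and $k$ searchers on the starting vertex; each move slides $j\ge1$ searchers along an edge $e$, requiring $j\ge w(e)$ if $e$ is contaminated, which then becomes clear; an edge $uv$ becomes contaminated whenever some edge $vy$ is contaminated and fewer than $w(v)$ searchers occupy $v$; the clear edges must form a connected subgraph after every move, and all edges are clear at the end. A strategy is monotone if no edge ever becomes recontaminated (so each edge is cleared exactly once). -}

module Defs where

open import Data.Nat using (ℕ; zero; suc; _+_; _*_; _∸_; _≤_; _<_; _⊔_)
open import Data.Fin using (Fin; toℕ; fromℕ; inject₁) renaming (zero to fzero; suc to fsuc)
open import Data.List using (List; foldr; map; allFin)
open import Data.Bool using (Bool; true; false; if_then_else_)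
open import Data.Product using (Σ; ∃; _×_; _,_)
open import Data.Sum using (_⊎_)
open import Relation.Binary.PropositionalEquality using (_≡_; _≢_)
open import Relation.Binary.Construct.Closure.ReflexiveTransitive using (Star)

-- Weighted graphs (positive weights on vertices and edges are not
-- enforced by the record; the concrete tree below has its weights).

record WGraph : Set₁ where
  field
    V    : Set
    E    : Set
    end₁ : E → V
    end₂ : E → V
    wV   : V → ℕ
    wE   : E → ℕ

module _ (G : WGraph) where
  open WGraph G

  Incident : V → E → Set
  Incident x e = (end₁ e ≡ x) ⊎ (end₂ e ≡ x)

  -- A configuration: number of searchers on each vertex, and which
  -- edges are clear (true) / contaminated (false).
  record State : Set where
    field
      cnt : V → ℕ
      clr : E → Bool
  open State public

  -- Sliding `num` searchers along `edge`, from end₁ to end₂ if fwd = true,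
  -- from end₂ to end₁ otherwise.
  record Move : Set where
    field
      edge : E
      fwd  : Bool
      num  : ℕ
  open Move public

  src dst : Move → V
  src m = if fwd m then end₁ (edge m) else end₂ (edge m)
  dst m = if fwd m then end₂ (edge m) else end₁ (edge m)

  ClearAdj : State → E → E → Set
  ClearAdj s e e' = (clr s e ≡ true) × (clr s e' ≡ true) × ∃ λ x → Incident x e × Incident x e'

  ClearConnected : State → Set
  ClearConnected s = ∀ e e' → clr s e ≡ true → clr s e' ≡ true → Star (ClearAdj s) e e'

  -- the recontamination rule fires nowhere: no vertex x with fewer than
  -- wV x searchers is incident to both a contaminated and a clear edge
  NoRecontamination : State → Set
  NoRecontamination s = ∀ x e e' → Incident x e → Incident x e' →
    clr s e ≡ false → clr s e' ≡ true → wV x ≤ cnt s x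

  MonotoneStep : State → Move → State → Set
  MonotoneStep s m s' =
      (1 ≤ num m)
    × (num m ≤ cnt s (src m))
    × (clr s (edge m) ≡ false → wE (edge m) ≤ num m)
    × (cnt s' (src m) + num m ≡ cnt s (src m))
    × (cnt s' (dst m) ≡ cnt s (dst m) + num m)
    × (∀ x → x ≢ src m → x ≢ dst m → cnt s' x ≡ cnt s x)
    × (clr s' (edge m) ≡ true)
    × (∀ e → e ≢ edge m → clr s' e ≡ clr s e)
    × NoRecontamination s'
    × ClearConnected s'

  record MonotoneConnectedStrategy (k : ℕ) (start : V) : Set where
    field
      len   : ℕ
      state : ℕ → State
      move  : ℕ → Move
      init-start : cnt (state 0) start ≡ k
      init-other : ∀ x → x ≢ start → cnt (state 0) x ≡ 0
      init-clr   : ∀ e → clr (state 0) e ≡ false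
      steps : ∀ i → i < len → MonotoneStep (state i) (move i) (state (suc i))
      final : ∀ e → clr (state len) e ≡ true

  ClearedAt : ∀ {k start} → MonotoneConnectedStrategy k start → ℕ → E → Set
  ClearedAt S i e = (i < len) × (edge (move i) ≡ e) × (clr (state i) e ≡ false)
    where open MonotoneConnectedStrategy S

maxList : List ℕ → ℕ
maxList = foldr _⊔_ 0

Lmax : (n : ℕ) → (Fin n → ℕ) → ℕ
Lmax n d = maxList (map d (allFin n))

IsF : (d : ℕ) → (p : ℕ → ℕ) → ℕ → Set
IsF d p f = (f < d) × (f + p f ≤ d) × (∀ t → t < d → t + p t ≤ d → t ≤ f)

module Tree (n : ℕ) (f : Fin n → ℕ) where

  -- y j, z j for j = 0..n ; u j i, v j i for task j (Fin n stands for 1..n), i = 0..f j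
  data TV : Set where
    r : TV
    y z : Fin (suc n) → TV
    u v : (j : Fin n) → Fin (suc (f j)) → TV

  data TE : Set where
    ry0 : TE
    ru  : Fin n → TE
    vy  : Fin n → TE
    yz  : Fin (suc n) → TE
    uv  : (j : Fin n) → Fin (suc (f j)) → TE
    vu  : (j : Fin n) → Fin (f j) → TE

  e₁ e₂ : TE → TV
  e₁ ry0      = r
  e₁ (ru j)   = r
  e₁ (vy j)   = v j fzero
  e₁ (yz k)   = y k
  e₁ (uv j i) = u j i
  e₁ (vu j i) = v j (inject₁ i)
  e₂ ry0      = y fzero
  e₂ (ru j)   = u j (fromℕ (f j))
  e₂ (vy j)   = y (fsuc j)
  e₂ (yz k)   = z k
  e₂ (uv j i) = v j i
  e₂ (vu j i) = u j (fsuc i)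

TreeGraph : (n : ℕ) (d : Fin n → ℕ) (p : Fin n → ℕ → ℕ) (f : Fin n → ℕ) → WGraph
TreeGraph n d p f = record
  { V = TV ; E = TE ; end₁ = e₁ ; end₂ = e₂ ; wV = wv ; wE = λ _ → 1 }
  where
    open Tree n f
    L = Lmax n d
    wv : TV → ℕ
    wv r       = 2 * L
    wv (y _)   = 3 * L
    wv (z _)   = 1
    wv (u j i) = 2 * L ∸ toℕ i
    wv (v j i) = p j (toℕ i)

module Submission where

-- Suppose r y₀ were cleared by move i' of a monotone connected
-- 4L-search strategy while some r uⱼ is cleared only later.  Right after move i'
-- the vertex r is incident to the clear edge r y₀ and the contaminated edge r uⱼ,
-- so it must hold w(r) = 2L searchers; likewise y₀ is incident to r y₀ and to
-- y₀ z₀, which is still contaminated because the branch y₀ z₀ can only be entered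
-- through r y₀, so y₀ must hold w(y₀) = 3L searchers.  Since searchers are only
-- ever moved, never created, r and y₀ together hold at most 4L, giving 5L ≤ 4L,
-- i.e. L = 0, contradicting d_j > f_j ≥ 0.

open import Defs
open import Data.Nat using (ℕ; zero; suc; _+_; _*_; _∸_; _≤_; _<_; z≤n)
open import Data.Nat.Properties
open import Data.Nat.ListAction using (sum)
open import Data.Nat.Tactic.RingSolver using (solve-∀)
open import Algebra.Properties.CommutativeSemigroup +-commutativeSemigroup
  using () renaming (interchange to +-interchange)
open import Data.Fin using (Fin) renaming (zero to fzero; suc to fsuc)
import Data.Fin.Properties as Fin
open import Data.List using (List; []; _∷_; map; allFin)
open import Data.List.Relation.Unary.Any using (here; there)
open import Data.List.Membership.Propositional using (_∈_)
open import Data.List.Membership.Propositional.Properties using (∈-allFin)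
open import Data.Unit using (⊤; tt)
import Data.Unit.Properties as Unit
open import Data.Product using (Σ; _×_; _,_; proj₁; proj₂)
import Data.Product.Properties as Product
open import Data.Sum using (_⊎_; inj₁; inj₂)
import Data.Sum.Properties as Sum
open import Data.Bool using (true; false)
open import Data.Empty using (⊥-elim)
open import Function using (_∘_)
open import Relation.Nullary using (¬_; yes; no)
open import Relation.Nullary.Decidable using (map′)
open import Relation.Binary.PropositionalEquality
open import Relation.Binary.Definitions using (DecidableEquality; tri<; tri≈; tri>)

record Transfer {A : Set} (c c' : A → ℕ) (s t : A) (num : ℕ) : Set where
  field
    from-source : c' s + num ≡ c s
    to-target   : c' t ≡ c t + num
    elsewhere   : ∀ x → x ≢ s → x ≢ t → c' x ≡ c x
open Transfer

transfer-distinct : ∀ {A : Set} {c c' : A → ℕ} {s t num} → Transfer c c' s t num → 1 ≤ num → s ≢ t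
transfer-distinct {c = c} {c'} {s} {num = num} T 1≤num refl = <-irrefl refl (begin-strict
    c' s         <⟨ m<m+n (c' s) 1≤num ⟩
    c' s + num   ≡⟨ from-source T ⟩
    c s          ≤⟨ m≤m+n (c s) num ⟩
    c s + num    ≡⟨ sym (to-target T) ⟩
    c' s         ∎)
  where open ≤-Reasoning

module SearcherCount {A : Set} (_≟_ : DecidableEquality A) where

  multiplicity : A → List A → ℕ
  multiplicity a [] = 0
  multiplicity a (x ∷ xs) with a ≟ x
  ... | yes _ = suc (multiplicity a xs)
  ... | no  _ = multiplicity a xs

  DuplicateFree : List A → Set
  DuplicateFree xs = ∀ a → multiplicity a xs ≤ 1

  AtMost : (A → ℕ) → ℕ → Set
  AtMost c K = ∀ xs → DuplicateFree xs → sum (map c xs) ≤ K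

  transfer-balance : ∀ {c c' s t num} → Transfer c c' s t num → s ≢ t → ∀ xs →
    sum (map c' xs) + multiplicity s xs * num ≡ sum (map c xs) + multiplicity t xs * num
  transfer-balance T s≢t [] = refl
  transfer-balance {c} {c'} {s} {t} {num} T s≢t (x ∷ xs)
    with s ≟ x | t ≟ x | transfer-balance T s≢t xs
  ... | yes refl | yes refl | _  = ⊥-elim (s≢t refl)
  ... | yes refl | no _ | ih = begin
      c' s + tot′ + (num + ms * num)  ≡⟨ +-interchange (c' s) tot′ num (ms * num) ⟩
      c' s + num + (tot′ + ms * num)  ≡⟨ cong₂ _+_ (from-source T) ih ⟩
      c s + (tot + mt * num)          ≡⟨ +-assoc (c s) tot (mt * num) ⟨
      c s + tot + mt * num            ∎
    where open ≡-Reasoning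
          tot′ tot ms mt : ℕ
          tot′ = sum (map c' xs); tot = sum (map c xs)
          ms = multiplicity s xs; mt = multiplicity t xs
  ... | no _ | yes refl | ih = begin
      c' t + tot′ + ms * num          ≡⟨ +-assoc (c' t) tot′ (ms * num) ⟩
      c' t + (tot′ + ms * num)        ≡⟨ cong₂ _+_ (to-target T) ih ⟩
      c t + num + (tot + mt * num)    ≡⟨ +-interchange (c t) num tot (mt * num) ⟩
      c t + tot + (num + mt * num)    ∎
    where open ≡-Reasoning
          tot′ tot ms mt : ℕ
          tot′ = sum (map c' xs); tot = sum (map c xs)
          ms = multiplicity s xs; mt = multiplicity t xs
  ... | no s≢x | no t≢x | ih = begin
      c' x + tot′ + ms * num          ≡⟨ +-assoc (c' x) tot′ (ms * num) ⟩
      c' x + (tot′ + ms * num)        ≡⟨ cong₂ _+_ (elsewhere T x (s≢x ∘ sym) (t≢x ∘ sym)) ih ⟩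
      c x + (tot + mt * num)          ≡⟨ +-assoc (c x) tot (mt * num) ⟨
      c x + tot + mt * num            ∎
    where open ≡-Reasoning
          tot′ tot ms mt : ℕ
          tot′ = sum (map c' xs); tot = sum (map c xs)
          ms = multiplicity s xs; mt = multiplicity t xs

  duplicateFree-cons : ∀ {s xs} → multiplicity s xs ≡ 0 → DuplicateFree xs → DuplicateFree (s ∷ xs)
  duplicateFree-cons {s} {xs} s∉xs free a with a ≟ s
  ... | yes refl = ≤-reflexive (cong suc s∉xs)
  ... | no  _    = free a

  atMost-transfer : ∀ {c c' s t num K} → Transfer c c' s t num → 1 ≤ num → num ≤ c s →
    AtMost c K → AtMost c' K
  atMost-transfer {c} {c'} {s} {t} {num} {K} T 1≤num num≤cs bound xs free =
    by-multiplicity (multiplicity s xs) refl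
    where
    open ≤-Reasoning
    tot′ tot : ℕ
    tot′ = sum (map c' xs)
    tot  = sum (map c xs)
    balance : tot′ + multiplicity s xs * num ≡ tot + multiplicity t xs * num
    balance = transfer-balance T (transfer-distinct T 1≤num) xs
    arriving≤num : multiplicity t xs * num ≤ num
    arriving≤num = ≤-trans (*-monoˡ-≤ num (free t)) (≤-reflexive (*-identityˡ num))
    -- if s ∉ xs, compare with the set s ∷ xs; otherwise with xs itself
    by-multiplicity : ∀ m → multiplicity s xs ≡ m → tot′ ≤ K
    by-multiplicity zero s∉xs = begin
      tot′                                ≡⟨ +-identityʳ tot′ ⟨
      tot′ + 0 * num                      ≡⟨ cong (λ m → tot′ + m * num) s∉xs ⟨
      tot′ + multiplicity s xs * num      ≡⟨ balance ⟩
      tot + multiplicity t xs * num       ≤⟨ +-monoʳ-≤ tot (≤-trans arriving≤num num≤cs) ⟩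
      tot + c s                           ≡⟨ +-comm tot (c s) ⟩
      sum (map c (s ∷ xs))                ≤⟨ bound (s ∷ xs) (duplicateFree-cons s∉xs free) ⟩
      K                                   ∎
    by-multiplicity (suc m) s∈xs = ≤-trans (+-cancelʳ-≤ num tot′ tot (begin
      tot′ + num                          ≤⟨ +-monoʳ-≤ tot′ (m≤m+n num (m * num)) ⟩
      tot′ + suc m * num                  ≡⟨ cong (λ m → tot′ + m * num) s∈xs ⟨
      tot′ + multiplicity s xs * num      ≡⟨ balance ⟩
      tot + multiplicity t xs * num       ≤⟨ +-monoʳ-≤ tot arriving≤num ⟩
      tot + num                           ∎)) (bound xs free)

  atMost-concentrated : ∀ {c st K} → c st ≡ K → (∀ x → x ≢ st → c x ≡ 0) → AtMost c K
  atMost-concentrated {c} {st} {K} at-st empty-elsewhere xs free = begin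
      sum (map c xs)                    ≡⟨ total xs ⟩
      multiplicity st xs * K            ≤⟨ *-monoˡ-≤ K (free st) ⟩
      1 * K                             ≡⟨ *-identityˡ K ⟩
      K                                 ∎
    where
    open ≤-Reasoning
    total : ∀ xs → sum (map c xs) ≡ multiplicity st xs * K
    total [] = refl
    total (x ∷ xs) with st ≟ x
    ... | yes refl = cong₂ _+_ at-st (total xs)
    ... | no st≢x  = cong₂ _+_ (empty-elsewhere x (st≢x ∘ sym)) (total xs)

true≢false : true ≢ false
true≢false ()

module StepFacts (G : WGraph) where
  open WGraph G

  src-incident : ∀ m → Incident G (src G m) (edge m)
  src-incident m with fwd m
  ... | true  = inj₁ refl
  ... | false = inj₂ refl

  dst-incident : ∀ m → Incident G (dst G m) (edge m)
  dst-incident m with fwd m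
  ... | true  = inj₂ refl
  ... | false = inj₁ refl

  step-transfer : ∀ {s m s'} → MonotoneStep G s m s' →
    Transfer (cnt s) (cnt s') (src G m) (dst G m) (num m)
  step-transfer (_ , _ , _ , from , to , others , _) = record
    { from-source = from ; to-target = to ; elsewhere = others }

  step-away : ∀ {s m s' x} → MonotoneStep G s m s' → ¬ Incident G x (edge m) → cnt s' x ≡ cnt s x
  step-away {m = m} {x = x} (_ , _ , _ , _ , _ , others , _) x∉m =
    others x (λ { refl → x∉m (src-incident m) }) (λ { refl → x∉m (dst-incident m) })

  step-occupied : ∀ {s m s'} → MonotoneStep G s m s' → Σ V (λ x → Incident G x (edge m) × 1 ≤ cnt s x)
  step-occupied {m = m} (1≤num , num≤src , _) = src G m , src-incident m , ≤-trans 1≤num num≤src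

  step-guarded : ∀ {s m s'} → MonotoneStep G s m s' → NoRecontamination G s'
  step-guarded (_ , _ , _ , _ , _ , _ , _ , _ , guarded , _) = guarded

  step-clears : ∀ {s m s'} → MonotoneStep G s m s' → clr s' (edge m) ≡ true
  step-clears (_ , _ , _ , _ , _ , _ , cleared , _) = cleared

  step-others : ∀ {s m s' e} → MonotoneStep G s m s' → e ≢ edge m → clr s' e ≡ clr s e
  step-others {e = e} (_ , _ , _ , _ , _ , _ , _ , unchanged , _) = unchanged e

  step-not-moved : ∀ {s m s' e} → MonotoneStep G s m s' → clr s' e ≡ false → e ≢ edge m
  step-not-moved step e-dirty refl = true≢false (trans (sym (step-clears step)) e-dirty)

  step-dirty-before : ∀ {s m s' e} → MonotoneStep G s m s' → clr s' e ≡ false → clr s e ≡ false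
  step-dirty-before step e-dirty = trans (sym (step-others step (step-not-moved step e-dirty))) e-dirty

  step-keeps-clear : ∀ {s m s' e} → MonotoneStep G s m s' → clr s e ≡ true → clr s' e ≡ true
  step-keeps-clear {s' = s'} {e = e} step e-clear with clr s' e in e-status
  ... | true  = refl
  ... | false = ⊥-elim (true≢false (trans (sym e-clear) (step-dirty-before step e-status)))

module StrategyFacts (G : WGraph) (_≟V_ : DecidableEquality (WGraph.V G))
  {k start} (S : MonotoneConnectedStrategy G k start) where
  open MonotoneConnectedStrategy S
  open StepFacts G
  open SearcherCount _≟V_

  clear-persists : ∀ {a e} b → a + b ≤ len → clr (state a) e ≡ true → clr (state (a + b)) e ≡ true
  clear-persists {a} zero _ e-clear rewrite +-identityʳ a = e-clear
  clear-persists {a} (suc b) a+b<len e-clear rewrite +-suc a b =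
    step-keeps-clear (steps (a + b) a+b<len) (clear-persists b (<⇒≤ a+b<len) e-clear)

  contaminated-until-cleared : ∀ {a i e} → ClearedAt G S i e → a ≤ i → clr (state a) e ≡ false
  contaminated-until-cleared {a} {i} {e} (i<len , _ , e-dirty) a≤i with clr (state a) e in e-status
  ... | false = refl
  ... | true  = ⊥-elim (true≢false (begin
      true                         ≡⟨ clear-persists (i ∸ a) (≤-trans (≤-reflexive a+[i∸a]≡i) (<⇒≤ i<len)) e-status ⟨
      clr (state (a + (i ∸ a))) e  ≡⟨ cong (λ j → clr (state j) e) a+[i∸a]≡i ⟩
      clr (state i) e              ≡⟨ e-dirty ⟩
      false                        ∎))
    where
    open ≡-Reasoning
    a+[i∸a]≡i : a + (i ∸ a) ≡ i
    a+[i∸a]≡i = m+[n∸m]≡n a≤i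

  searchers-bounded : ∀ i → i ≤ len → AtMost (cnt (state i)) k
  searchers-bounded zero _ = atMost-concentrated init-start init-other
  searchers-bounded (suc i) i<len =
    atMost-transfer (step-transfer step) (proj₁ step) (proj₁ (proj₂ step))
      (searchers-bounded i (<⇒≤ i<len))
    where
    step : MonotoneStep G (state i) (move i) (state (suc i))
    step = steps i i<len

deadline≤Lmax : ∀ {n} (d : Fin n → ℕ) (j : Fin n) → d j ≤ Lmax n d
deadline≤Lmax {n} d j = below-max (allFin n) (∈-allFin j)
  where
  below-max : ∀ xs → j ∈ xs → d j ≤ maxList (map d xs)
  below-max (x ∷ xs) (here refl)  = m≤m⊔n (d x) _
  below-max (x ∷ xs) (there j∈xs) = ≤-trans (below-max xs j∈xs) (m≤n⊔m (d x) _)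

module TreeVertices (n : ℕ) (f : Fin n → ℕ) where
  open Tree n f

  -- vertices of T are coded injectively by data with decidable equality
  PathVertex : Set
  PathVertex = Σ (Fin n) (λ j → Fin (suc (f j)))

  Code : Set
  Code = ⊤ ⊎ Fin (suc n) ⊎ Fin (suc n) ⊎ PathVertex ⊎ PathVertex

  encode : TV → Code
  encode r       = inj₁ tt
  encode (y k)   = inj₂ (inj₁ k)
  encode (z k)   = inj₂ (inj₂ (inj₁ k))
  encode (u j i) = inj₂ (inj₂ (inj₂ (inj₁ (j , i))))
  encode (v j i) = inj₂ (inj₂ (inj₂ (inj₂ (j , i))))

  decode : Code → TV
  decode (inj₁ _)                           = r
  decode (inj₂ (inj₁ k))                    = y k
  decode (inj₂ (inj₂ (inj₁ k)))             = z k
  decode (inj₂ (inj₂ (inj₂ (inj₁ (j , i))))) = u j i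
  decode (inj₂ (inj₂ (inj₂ (inj₂ (j , i))))) = v j i

  decode-encode : ∀ a → decode (encode a) ≡ a
  decode-encode r       = refl
  decode-encode (y _)   = refl
  decode-encode (z _)   = refl
  decode-encode (u _ _) = refl
  decode-encode (v _ _) = refl

  _≟C_ : DecidableEquality Code
  _≟C_ = Sum.≡-dec Unit._≟_ (Sum.≡-dec Fin._≟_ (Sum.≡-dec Fin._≟_ (Sum.≡-dec path≟ path≟)))
    where
    path≟ : DecidableEquality PathVertex
    path≟ = Product.≡-dec Fin._≟_ Fin._≟_

  _≟V_ : DecidableEquality TV
  a ≟V b = map′ encode-injective (cong encode) (encode a ≟C encode b)
    where
    encode-injective : encode a ≡ encode b → a ≡ b
    encode-injective eq = trans (sym (decode-encode a)) (trans (cong decode eq) (decode-encode b))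

module RootEdgeOrder (n : ℕ) (d : Fin n → ℕ) (p : Fin n → ℕ → ℕ) (f : Fin n → ℕ)
  (S : MonotoneConnectedStrategy (TreeGraph n d p f) (4 * Lmax n d) Tree.r) where
  open Tree n f
  open TreeVertices n f
  G = TreeGraph n d p f
  L = Lmax n d
  open MonotoneConnectedStrategy S
  open StepFacts G
  open StrategyFacts G _≟V_ S
  open SearcherCount _≟V_

  edges-at-y0 : ∀ e → Incident G (y fzero) e → e ≡ ry0 ⊎ e ≡ yz fzero
  edges-at-y0 ry0          _        = inj₁ refl
  edges-at-y0 (yz fzero)   _        = inj₂ refl
  edges-at-y0 (ru _)       (inj₁ ())
  edges-at-y0 (ru _)       (inj₂ ())
  edges-at-y0 (vy _)       (inj₁ ())
  edges-at-y0 (vy _)       (inj₂ ())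
  edges-at-y0 (yz (fsuc _)) (inj₁ ())
  edges-at-y0 (yz (fsuc _)) (inj₂ ())
  edges-at-y0 (uv _ _)     (inj₁ ())
  edges-at-y0 (uv _ _)     (inj₂ ())
  edges-at-y0 (vu _ _)     (inj₁ ())
  edges-at-y0 (vu _ _)     (inj₂ ())

  edges-at-z0 : ∀ e → Incident G (z fzero) e → e ≡ yz fzero
  edges-at-z0 (yz fzero)   _        = refl
  edges-at-z0 ry0          (inj₁ ())
  edges-at-z0 ry0          (inj₂ ())
  edges-at-z0 (ru _)       (inj₁ ())
  edges-at-z0 (ru _)       (inj₂ ())
  edges-at-z0 (vy _)       (inj₁ ())
  edges-at-z0 (vy _)       (inj₂ ())
  edges-at-z0 (yz (fsuc _)) (inj₁ ())
  edges-at-z0 (yz (fsuc _)) (inj₂ ())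
  edges-at-z0 (uv _ _)     (inj₁ ())
  edges-at-z0 (uv _ _)     (inj₂ ())
  edges-at-z0 (vu _ _)     (inj₁ ())
  edges-at-z0 (vu _ _)     (inj₂ ())

  BranchUnentered : State G → Set
  BranchUnentered s = (cnt s (y fzero) ≡ 0) × (cnt s (z fzero) ≡ 0) × (clr s (yz fzero) ≡ false)

  branch-stays-unentered : ∀ {s m s'} → MonotoneStep G s m s' → clr s' ry0 ≡ false →
    BranchUnentered s → BranchUnentered s'
  branch-stays-unentered {s} {m} step ry0-dirty (y0-empty , z0-empty , yz0-dirty) =
      trans (step-away step y0∉m) y0-empty
    , trans (step-away step z0∉m) z0-empty
    , trans (step-others step yz0≢m) yz0-dirty
    where
    no-searcher : ∀ {x} → cnt s x ≡ 0 → ¬ 1 ≤ cnt s x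
    no-searcher empty occupied with () ← ≤-trans occupied (≤-reflexive empty)
    -- y₀ z₀ cannot be moved along: both its endpoints are empty
    yz0≢m : yz fzero ≢ edge m
    yz0≢m eq with step-occupied step
    ... | x , x∈m , occupied with subst (Incident G x) (sym eq) x∈m
    ...   | inj₁ refl = no-searcher y0-empty occupied
    ...   | inj₂ refl = no-searcher z0-empty occupied
    y0∉m : ¬ Incident G (y fzero) (edge m)
    y0∉m y0∈m with edges-at-y0 (edge m) y0∈m
    ... | inj₁ eq = step-not-moved step ry0-dirty (sym eq)
    ... | inj₂ eq = yz0≢m (sym eq)
    z0∉m : ¬ Incident G (z fzero) (edge m)
    z0∉m z0∈m = yz0≢m (sym (edges-at-z0 (edge m) z0∈m))

  -- the branch can only be entered through r y₀, so it is unentered while r y₀ is contaminated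
  branch-unentered : ∀ i → i ≤ len → clr (state i) ry0 ≡ false → BranchUnentered (state i)
  branch-unentered zero _ _ = init-other (y fzero) (λ ()) , init-other (z fzero) (λ ()) , init-clr (yz fzero)
  branch-unentered (suc i) i<len ry0-dirty =
    branch-stays-unentered step ry0-dirty
      (branch-unentered i (<⇒≤ i<len) (step-dirty-before step ry0-dirty))
    where
    step : MonotoneStep G (state i) (move i) (state (suc i))
    step = steps i i<len

  cannot-guard-r-and-y0 : (s : State G) → AtMost (cnt s) (4 * L) →
    2 * L ≤ cnt s r → 3 * L ≤ cnt s (y fzero) → L ≡ 0
  cannot-guard-r-and-y0 s bound r-guarded y0-guarded = n≤0⇒n≡0 (+-cancelˡ-≤ (4 * L) L 0 (begin
      4 * L + L                           ≡⟨ split-5L L ⟩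
      2 * L + (3 * L + 0)                 ≤⟨ +-mono-≤ r-guarded (+-monoˡ-≤ 0 y0-guarded) ⟩
      sum (map (cnt s) (r ∷ y fzero ∷ [])) ≤⟨ bound (r ∷ y fzero ∷ []) r-y0-distinct ⟩
      4 * L                               ≡⟨ +-identityʳ (4 * L) ⟨
      4 * L + 0                           ∎))
    where
    open ≤-Reasoning
    r-y0-distinct : DuplicateFree (r ∷ y fzero ∷ [])
    r-y0-distinct = duplicateFree-cons refl (duplicateFree-cons refl (λ _ → z≤n))
    split-5L : ∀ m → 4 * m + m ≡ 2 * m + (3 * m + 0)
    split-5L = solve-∀

  -- if r y₀ were cleared (move i') before r uⱼ (move i), then right after move i'
  -- both r (next to contaminated r uⱼ) and y₀ (next to contaminated y₀ z₀) must be guarded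
  ry0-cleared-before-ru-forces-L≡0 : ∀ j i i' → ClearedAt G S i (ru j) → ClearedAt G S i' ry0 → i' < i → L ≡ 0
  ry0-cleared-before-ru-forces-L≡0 j i i' ru-at-i (i'<len , moved-ry0 , ry0-dirty) i'<i =
    cannot-guard-r-and-y0 after (searchers-bounded (suc i') i'<len)
      (guarded r (ru j) ry0 (inj₁ refl) (inj₁ refl) ru-dirty ry0-clear)
      (guarded (y fzero) (yz fzero) ry0 (inj₁ refl) (inj₂ refl) yz0-dirty ry0-clear)
    where
    after : State G
    after = state (suc i')
    step : MonotoneStep G (state i') (move i') after
    step = steps i' i'<len
    guarded : NoRecontamination G after
    guarded = step-guarded step
    ry0-clear : clr after ry0 ≡ true
    ry0-clear = subst (λ e → clr after e ≡ true) moved-ry0 (step-clears step)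
    ru-dirty : clr after (ru j) ≡ false
    ru-dirty = contaminated-until-cleared ru-at-i i'<i
    yz0-dirty : clr after (yz fzero) ≡ false
    yz0-dirty = trans (step-others step (λ yz0≡m → yz0≢ry0 (trans yz0≡m moved-ry0)))
                  (proj₂ (proj₂ (branch-unentered i' (<⇒≤ i'<len) ry0-dirty)))
      where yz0≢ry0 : yz fzero ≢ ry0
            yz0≢ry0 ()

  ry0-cleared-last : 0 < L → ∀ j i i' → ClearedAt G S i (ru j) → ClearedAt G S i' ry0 → i < i'
  ry0-cleared-last L>0 j i i' ru-at-i ry0-at-i' with <-cmp i i'
  ... | tri< i<i' _ _ = i<i'
  ... | tri≈ _ refl _ with () ← trans (sym (proj₁ (proj₂ ru-at-i))) (proj₁ (proj₂ ry0-at-i'))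
  ... | tri> _ _ i'<i = ⊥-elim (<⇒≢ L>0 (sym (ry0-cleared-before-ru-forces-L≡0 j i i' ru-at-i ry0-at-i' i'<i)))


lemma11 : (n : ℕ) (d : Fin n → ℕ) (p : Fin n → ℕ → ℕ) (f : Fin n → ℕ)
    → (∀ j t → t < d j → 1 ≤ p j t)
    → (∀ j s t → s ≤ t → t < d j → p j s ≤ p j t)
    → (∀ j → IsF (d j) (p j) (f j))
    → (S : MonotoneConnectedStrategy (TreeGraph n d p f) (4 * Lmax n d) (Tree.r))
    → ∀ j i i' → ClearedAt (TreeGraph n d p f) S i (Tree.ru j) → ClearedAt (TreeGraph n d p f) S i' Tree.ry0
    → i < i'
lemma11 n d p f _ _ isF S j = RootEdgeOrder.ry0-cleared-last n d p f S L-positive j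
  where
  -- L ≥ d_j > f_j ≥ 0
  L-positive : 0 < Lmax n d
  L-positive = <-≤-trans (≤-<-trans z≤n (proj₁ (isF j))) (deadline≤Lmax d j)
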